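{- Any zero forcing process on a graph $G$ is a rigid linkage forcing process; that is, if the forces of a zero forcing process are performed in the same order starting from the same initial blue set, each of them is a valid $\operatorname{RL}$-force.
   Context: Zero forcing: vertices are blue or white; starting from an initial blue set, a step applies the rule: if a blue vertex $u$ has exactly one white neighbor $w$, color $w$ blue ($u\to w$). A zero forcing process is a sequence of such steps. $\operatorname{RL}$-forcing: blue vertices are additionally active or inactive. Initially a blue set $B^0$ is chosen, all active. Given blue set $B^k$ and active set $B_a^k$, a step chooses a component $K$ of $G-B^k$ such that no vertex outside $K$ with a neighbor in $K$ is an inactive blue vertex, and an active blue vertex $u$ such that $w$ is the only white neighbor of $u$ in $K$; then $B^{k+1}=B^k\cup\{w\}$ and $B_a^{k+1}=(B_a^k\setminus\{u\})\cup\{w\}$ ($u\to w$ is an $\operatorname{RL}$-force). A rigid linkage forcing process is a sequence of such steps. -}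

module Defs where

open import Data.Nat using (ℕ)
open import Data.Fin using (Fin)
open import Data.Product using (Σ; _×_; _,_; ∃)
open import Data.Sum using (_⊎_)
open import Data.List using (List; []; _∷_)
open import Relation.Nullary using (¬_; Dec)
open import Relation.Binary.PropositionalEquality using (_≡_; _≢_)

record Graph (n : ℕ) : Set₁ where
  field
    Adj     : Fin n → Fin n → Set
    adj?    : ∀ x y → Dec (Adj x y)
    sym     : ∀ {x y} → Adj x y → Adj y x
    irrefl  : ∀ {x} → ¬ Adj x x

open Graph public

VSet : ℕ → Set₁
VSet n = Fin n → Set

_∪﹛_﹜ : ∀ {n} → VSet n → Fin n → VSet n
(S ∪﹛ w ﹜) v = S v ⊎ v ≡ w

swap : ∀ {n} → VSet n → Fin n → Fin n → VSet n
swap S u w v = (S v × v ≢ u) ⊎ v ≡ w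

-- Reach G B x y : y lies in the same component of G - B as the (white) vertex x,
-- i.e. there is a walk from x to y using only white (non-B) vertices.
data Reach {n} (G : Graph n) (B : VSet n) (x : Fin n) : Fin n → Set where
  here : ¬ B x → Reach G B x x
  step : ∀ {y z} → Reach G B x y → Adj G y z → ¬ B z → Reach G B x z

ZFForce : ∀ {n} → Graph n → VSet n → Fin n → Fin n → Set
ZFForce G B u w =
  B u × ¬ B w × Adj G u w × (∀ v → Adj G u v → ¬ B v → v ≡ w)

data ZFProcess {n} (G : Graph n) : VSet n → List (Fin n × Fin n) → Set₁ where
  done  : ∀ {B} → ZFProcess G B []
  force : ∀ {B u w fs} → ZFForce G B u w → ZFProcess G (B ∪﹛ w ﹜) fs
        → ZFProcess G B ((u , w) ∷ fs)

-- RL-force u → w with blue set B and active set A: there is a component K of G - B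
-- (K = the component containing the white vertex x) such that no vertex outside K
-- with a neighbour in K is an inactive blue vertex, u is active, and w is the only
-- white neighbour of u in K.
RLForce : ∀ {n} → Graph n → VSet n → VSet n → Fin n → Fin n → Set
RLForce {n} G B A u w =
  Σ (Fin n) λ x → ¬ B x ×
    ( (∀ v → ¬ Reach G B x v → (∃ λ y → Reach G B x y × Adj G v y) → ¬ (B v × ¬ A v))
    × A u
    × Reach G B x w × ¬ B w × Adj G u w
    × (∀ v → Reach G B x v → ¬ B v → Adj G u v → v ≡ w))

data RLProcess {n} (G : Graph n) : VSet n → VSet n → List (Fin n × Fin n) → Set₁ where
  done  : ∀ {B A} → RLProcess G B A []
  force : ∀ {B A u w fs} → RLForce G B A u w
        → RLProcess G (B ∪﹛ w ﹜) (swap A u w) fs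
        → RLProcess G B A ((u , w) ∷ fs)

module Submission where

open import Defs
open import Data.Nat using (ℕ)
open import Data.Fin using (Fin; _≟_)
open import Data.Product using (_×_; _,_)
open import Data.Sum using (_⊎_; inj₁; inj₂)
open import Data.List using (List; []; _∷_)
open import Data.Empty using (⊥-elim)
open import Function using (_∘_)
open import Relation.Nullary using (¬_; yes; no)
open import Relation.Binary.PropositionalEquality using (refl)

-- Proof idea: along a zero forcing process every blue vertex is either still
-- active or has no white neighbour. A forcing vertex u is active, since its
-- white neighbour w exists, and after the force u has no white neighbour left,
-- so deactivating it keeps the invariant. Take K to be the component of G - B
-- containing w: a blue vertex next to K has a white neighbour, hence is active,
-- and the only white neighbour of u at all is w.

module _ {n} (G : Graph n) where

  -- Stated doubly negated because blue sets are arbitrary, undecidable predicates.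
  NoWhiteNeighbour : VSet n → Fin n → Set
  NoWhiteNeighbour B v = ∀ y → Adj G v y → ¬ ¬ B y

  ActiveOrSaturated : VSet n → VSet n → Set
  ActiveOrSaturated B A = ∀ v → B v → A v ⊎ NoWhiteNeighbour B v

  NoWhiteNeighbour-∪ : ∀ {B v} w → NoWhiteNeighbour B v → NoWhiteNeighbour (B ∪﹛ w ﹜) v
  NoWhiteNeighbour-∪ w noWhite y v~y ¬B′y = noWhite y v~y (¬B′y ∘ inj₁)

  Reach-white : ∀ {B x y} → Reach G B x y → ¬ B y
  Reach-white (here ¬Bx)      = ¬Bx
  Reach-white (step _ _ ¬By) = ¬By

  ActiveOrSaturated-initial : ∀ B → ActiveOrSaturated B B
  ActiveOrSaturated-initial B v = inj₁

  blue-next-to-white-active : ∀ {B A v y} → ActiveOrSaturated B A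
    → ¬ B y → Adj G v y → ¬ (B v × ¬ A v)
  blue-next-to-white-active inv ¬By v~y (Bv , ¬Av) with inv _ Bv
  ... | inj₁ Av      = ¬Av Av
  ... | inj₂ noWhite = noWhite _ v~y ¬By

  forcer-active : ∀ {B A u w} → ActiveOrSaturated B A → ZFForce G B u w → A u
  forcer-active {u = u} inv (Bu , ¬Bw , u~w , _) with inv u Bu
  ... | inj₁ Au      = Au
  ... | inj₂ noWhite = ⊥-elim (noWhite _ u~w ¬Bw)

  forcer-saturated : ∀ {B u w} → ZFForce G B u w → NoWhiteNeighbour (B ∪﹛ w ﹜) u
  forcer-saturated (_ , _ , _ , unique) y u~y ¬B′y =
    ¬B′y (inj₂ (unique y u~y (¬B′y ∘ inj₁)))

  ActiveOrSaturated-force : ∀ {B A u w} → ActiveOrSaturated B A → ZFForce G B u w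
    → ActiveOrSaturated (B ∪﹛ w ﹜) (swap A u w)
  ActiveOrSaturated-force inv f v (inj₂ v≡w) = inj₁ (inj₂ v≡w)
  ActiveOrSaturated-force {u = u} {w} inv f v (inj₁ Bv) with v ≟ u
  ... | yes refl = inj₂ (forcer-saturated f)
  ... | no v≢u with inv v Bv
  ...   | inj₁ Av      = inj₁ (inj₁ (Av , v≢u))
  ...   | inj₂ noWhite = inj₂ (NoWhiteNeighbour-∪ w noWhite)

  zf-force⇒rl-force : ∀ {B A u w} → ActiveOrSaturated B A → ZFForce G B u w
    → RLForce G B A u w
  zf-force⇒rl-force inv f@(_ , ¬Bw , u~w , unique) =
    _ , ¬Bw
      , (λ v _ (y , w⇝y , v~y) → blue-next-to-white-active inv (Reach-white w⇝y) v~y)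
      , forcer-active inv f
      , here ¬Bw , ¬Bw , u~w
      , (λ v _ ¬Bv u~v → unique v u~v ¬Bv)

  zf⇒rl : ∀ {B A fs} → ActiveOrSaturated B A → ZFProcess G B fs → RLProcess G B A fs
  zf⇒rl inv done        = done
  zf⇒rl inv (force f p) =
    force (zf-force⇒rl-force inv f) (zf⇒rl (ActiveOrSaturated-force inv f) p)

proposition2p3 : ∀ {n} (G : Graph n) (B₀ : VSet n) (fs : List (Fin n × Fin n))
    → ZFProcess G B₀ fs → RLProcess G B₀ B₀ fs
proposition2p3 G B₀ fs = zf⇒rl G (ActiveOrSaturated-initial G B₀)
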